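{- Let $k \ge 0$ be an integer, and let $\ell$ be an integer with $1 \le \ell \le 2(4k+3)$ and $\gcd(\ell, 4k+3) = 1$. Put $$M = \frac{16\,\ell\,(4k+3) - 4\ell^{2}}{(\gcd(\ell,4))^{2}}.$$ Let $p$ be a prime with $p \equiv -(4k+3) \pmod M$. Then $$\frac{4}{p} = \frac{4}{p+(4k+3)} + \frac{4(4k+3)-\ell}{p\big(p+(4k+3)\big)} + \frac{\ell}{p\big(p+(4k+3)\big)},$$ and each of the three fractions on the right is a unit fraction, i.e. of the form $1/N$ for a positive integer $N$. Hence this gives a solution $\frac{4}{p} = \frac{1}{x}+\frac{1}{y}+\frac{1}{z}$ in positive integers. -}

module Defs where

open import Data.Nat using (ℕ; zero; suc; _+_; _*_; _∸_; _^_)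
import Data.Nat as ℕ
open import Data.Nat.GCD using (gcd)
open import Data.Integer using (ℤ; +_)
open import Data.Rational using (ℚ; 0ℚ; _/_)
open import Data.Product using (∃-syntax)
open import Relation.Binary.PropositionalEquality using (_≡_)

-- Total natural-number division (returns 0 for divisor 0; only used with
-- nonzero divisors below).
divℕ : ℕ → ℕ → ℕ
divℕ m zero    = 0
divℕ m (suc d) = ℕ._/_ m (suc d)

-- The rational number n / d (returns 0 for d = 0; only used with positive d).
frac : ℤ → ℕ → ℚ
frac n zero    = 0ℚ
frac n (suc d) = n / suc d

Q : ℕ → ℕ
Q k = 4 * k + 3

-- M = (16 ℓ (4k+3) - 4 ℓ²) / gcd(ℓ,4)²   (the numerator is positive and
-- divisible by gcd(ℓ,4)² under the hypotheses, so ∸ and / are exact)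
M : ℕ → ℕ → ℕ
M k ℓ = divℕ (16 * ℓ * Q k ∸ 4 * ℓ * ℓ) (gcd ℓ 4 ^ 2)

IsUnitFraction : ℚ → Set
IsUnitFraction r = ∃[ N ] (r ≡ + 1 / suc N)

-- Writing q = 4k+3, t = 4q − ℓ and g = gcd(ℓ,4), the identity is
-- 4/p = 4(p+q)/(p(p+q)) = 4/(p+q) + 4q/(p(p+q)) with 4q = t + ℓ.  Since g divides
-- 4, ℓ and t, the modulus M = 4ℓt/g² is a multiple of each of 4, ℓ and t, so
-- M ∣ p + q makes all three numerators divide their denominators.
module Submission where

open import Defs
open import Data.Nat as ℕ using (ℕ; zero; suc; _+_; _*_; _∸_; _^_; _≤_)
import Data.Nat.Properties as ℕ
open import Data.Nat.DivMod using (m*n/n≡m)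
open import Data.Nat.GCD using (gcd; gcd[m,n]∣m; gcd[m,n]∣n; gcd[m,n]≢0)
open import Data.Nat.Divisibility using (_∣_; divides; divides-refl; ∣-trans; ∣n⇒∣m*n; ∣m⇒∣m*n)
open import Data.Nat.Primality using (Prime; ¬prime[0])
open import Data.Nat.Tactic.RingSolver using (solve-∀)
open import Data.Integer as ℤ using (+_; _-_)
import Data.Integer.Properties as ℤ
open import Data.Integer.Tactic.RingSolver using () renaming (solve-∀ to ℤ-solve-∀)
open import Data.Rational as ℚ using (fromℚᵘ) renaming (_+_ to _+ℚ_)
import Data.Rational.Properties as ℚ
open import Data.Rational.Unnormalised as ℚᵘ using (mkℚᵘ; *≡*)
import Data.Rational.Unnormalised.Properties as ℚᵘ
open import Data.Product using (_×_; _,_; proj₁; proj₂)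
open import Data.Sum using (inj₂)
open import Data.Empty using (⊥-elim)
open import Relation.Binary.PropositionalEquality

fromℚᵘ-homo-+ : ∀ x y → fromℚᵘ (x ℚᵘ.+ y) ≡ fromℚᵘ x +ℚ fromℚᵘ y
fromℚᵘ-homo-+ x y = ℚ.toℚᵘ-injective (begin-equality
  ℚ.toℚᵘ (fromℚᵘ (x ℚᵘ.+ y))                ≃⟨ ℚ.toℚᵘ-fromℚᵘ (x ℚᵘ.+ y) ⟩
  x ℚᵘ.+ y                                   ≃⟨ ℚᵘ.+-cong (ℚ.toℚᵘ-fromℚᵘ x) (ℚ.toℚᵘ-fromℚᵘ y) ⟨
  ℚ.toℚᵘ (fromℚᵘ x) ℚᵘ.+ ℚ.toℚᵘ (fromℚᵘ y)  ≃⟨ ℚ.toℚᵘ-homo-+ (fromℚᵘ x) (fromℚᵘ y) ⟨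
  ℚ.toℚᵘ (fromℚᵘ x +ℚ fromℚᵘ y)             ∎)
  where open ℚᵘ.≤-Reasoning

frac-+ : ∀ a b d e → frac a (suc d) +ℚ frac b (suc e) ≡ frac (a ℤ.* + suc e ℤ.+ b ℤ.* + suc d) (suc d * suc e)
frac-+ a b d e = sym (fromℚᵘ-homo-+ (mkℚᵘ a d) (mkℚᵘ b e))

frac-cong : ∀ a b d e → a ℤ.* + suc e ≡ b ℤ.* + suc d → frac a (suc d) ≡ frac b (suc e)
frac-cong a b d e eq = ℚ.fromℚᵘ-cong {mkℚᵘ a d} {mkℚᵘ b e} (*≡* eq)

frac-cancelʳ : ∀ a c d → frac (a ℤ.* + suc c) (suc d * suc c) ≡ frac a (suc d)
frac-cancelʳ a c d = frac-cong (a ℤ.* + suc c) a (c + d * suc c) d (begin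
  a ℤ.* + suc c ℤ.* + suc d    ≡⟨ swap a (+ suc c) (+ suc d) ⟩
  a ℤ.* (+ suc d ℤ.* + suc c)  ≡⟨ cong (a ℤ.*_) (ℤ.pos-* (suc d) (suc c)) ⟨
  a ℤ.* + (suc d * suc c)      ∎)
  where
  open ≡-Reasoning
  swap : ∀ x y z → x ℤ.* y ℤ.* z ≡ x ℤ.* (z ℤ.* y)
  swap = ℤ-solve-∀

frac-+-sameDenom : ∀ a b d → frac a (suc d) +ℚ frac b (suc d) ≡ frac (a ℤ.+ b) (suc d)
frac-+-sameDenom a b d = begin
  frac a (suc d) +ℚ frac b (suc d)                         ≡⟨ frac-+ a b d d ⟩
  frac (a ℤ.* + suc d ℤ.+ b ℤ.* + suc d) (suc d * suc d)   ≡⟨ cong (λ x → frac x (suc d * suc d)) (ℤ.*-distribʳ-+ (+ suc d) a b) ⟨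
  frac ((a ℤ.+ b) ℤ.* + suc d) (suc d * suc d)             ≡⟨ frac-cancelʳ (a ℤ.+ b) d d ⟩
  frac (a ℤ.+ b) (suc d)                                   ∎
  where open ≡-Reasoning

frac-split : ∀ n m c p q → m ≡ n ℤ.* + q →
  frac n (suc p) ≡ (frac n (suc p + q) +ℚ frac (m - c) (suc p * (suc p + q))) +ℚ frac c (suc p * (suc p + q))
frac-split n m c p q m≡nq = sym (begin
  (frac n P +ℚ frac (m - c) D) +ℚ frac c D                ≡⟨ cong (λ x → (x +ℚ frac (m - c) D) +ℚ frac c D) n/P≡np/D ⟩
  (frac (n ℤ.* + suc p) D +ℚ frac (m - c) D) +ℚ frac c D  ≡⟨ cong (_+ℚ frac c D) (frac-+-sameDenom (n ℤ.* + suc p) (m - c) _) ⟩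
  frac (n ℤ.* + suc p ℤ.+ (m - c)) D +ℚ frac c D          ≡⟨ frac-+-sameDenom (n ℤ.* + suc p ℤ.+ (m - c)) c _ ⟩
  frac (n ℤ.* + suc p ℤ.+ (m - c) ℤ.+ c) D                ≡⟨ cong (λ x → frac x D) numerator ⟩
  frac (n ℤ.* + P) D                                      ≡⟨ frac-cancelʳ n (p + q) p ⟩
  frac n (suc p)                                          ∎)
  where
  open ≡-Reasoning
  P = suc p + q
  D = suc p * P
  n/P≡np/D : frac n P ≡ frac (n ℤ.* + suc p) D
  n/P≡np/D = trans (sym (frac-cancelʳ n p (p + q))) (cong (frac (n ℤ.* + suc p)) (ℕ.*-comm P (suc p)))
  collect : ∀ n x y c → n ℤ.* x ℤ.+ (n ℤ.* y - c) ℤ.+ c ≡ n ℤ.* (x ℤ.+ y)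
  collect = ℤ-solve-∀
  numerator : n ℤ.* + suc p ℤ.+ (m - c) ℤ.+ c ≡ n ℤ.* + P
  numerator = begin
    n ℤ.* + suc p ℤ.+ (m - c) ℤ.+ c          ≡⟨ cong (λ x → n ℤ.* + suc p ℤ.+ (x - c) ℤ.+ c) m≡nq ⟩
    n ℤ.* + suc p ℤ.+ (n ℤ.* + q - c) ℤ.+ c  ≡⟨ collect n (+ suc p) (+ q) c ⟩
    n ℤ.* (+ suc p ℤ.+ + q)                  ≡⟨ cong (n ℤ.*_) (ℤ.pos-+ (suc p) q) ⟨
    n ℤ.* + P                                ∎

∣⇒isUnitFraction : ∀ n d → n ∣ suc d → IsUnitFraction (frac (+ n) (suc d))
∣⇒isUnitFraction n d (divides (suc c) eq) = c , frac-cong (+ n) (+ 1) d c (begin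
  + n ℤ.* + suc c   ≡⟨ ℤ.pos-* n (suc c) ⟨
  + (n * suc c)     ≡⟨ cong +_ (trans (ℕ.*-comm n (suc c)) (sym eq)) ⟩
  + suc d           ≡⟨ ℤ.*-identityˡ (+ suc d) ⟨
  + 1 ℤ.* + suc d   ∎)
  where open ≡-Reasoning

pos-∸ : ∀ {m n} → n ≤ m → + m - + n ≡ + (m ∸ n)
pos-∸ {m} {n} n≤m = trans (ℤ.m-n≡m⊖n m n) (ℤ.⊖-≥ n≤m)

∣m∣n⇒∣m∸n : ∀ {d m n} → d ∣ m → d ∣ n → d ∣ m ∸ n
∣m∣n⇒∣m∸n {d} (divides-refl p) (divides-refl q) = divides (p ∸ q) (sym (ℕ.*-distribʳ-∸ d p q))

divℕ-product/square : ∀ a b c g → divℕ (a * suc g * (b * suc g) * (c * suc g)) (suc g ^ 2) ≡ a * b * c * suc g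
divℕ-product/square a b c g =
  trans (cong (λ x → divℕ x (suc g ^ 2)) (spread a b c (suc g))) (m*n/n≡m (a * b * c * suc g) (suc g ^ 2))
  where
  -- g * (g * 1) is the definitional unfolding of g ^ 2.
  spread : ∀ a b c g → a * g * (b * g) * (c * g) ≡ a * b * c * g * (g * (g * 1))
  spread = solve-∀

∣-product/square : ∀ {g a b c} → g ≢ 0 → g ∣ a → g ∣ b → g ∣ c →
  let N = divℕ (a * b * c) (g ^ 2) in a ∣ N × b ∣ N × c ∣ N
∣-product/square {zero} g≢0 _ _ _ = ⊥-elim (g≢0 refl)
∣-product/square {suc g} _ (divides-refl a) (divides-refl b) (divides-refl c)
  rewrite divℕ-product/square a b c g =
  divides (b * c) (pullˡ a b c (suc g)) , divides (a * c) (pullᵐ a b c (suc g)) , divides (a * b) (pullʳ a b c (suc g))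
  where
  pullˡ : ∀ a b c g → a * b * c * g ≡ b * c * (a * g)
  pullˡ = solve-∀
  pullᵐ : ∀ a b c g → a * b * c * g ≡ a * c * (b * g)
  pullᵐ = solve-∀
  pullʳ : ∀ a b c g → a * b * c * g ≡ a * b * (c * g)
  pullʳ = solve-∀

M≡4ℓt/g² : ∀ k ℓ → M k ℓ ≡ divℕ (4 * ℓ * (4 * Q k ∸ ℓ)) (gcd ℓ 4 ^ 2)
M≡4ℓt/g² k ℓ = cong (λ x → divℕ x (gcd ℓ 4 ^ 2)) (begin
  16 * ℓ * Q k ∸ 4 * ℓ * ℓ          ≡⟨ cong (_∸ 4 * ℓ * ℓ) (regroup ℓ (Q k)) ⟩
  4 * ℓ * (4 * Q k) ∸ 4 * ℓ * ℓ     ≡⟨ ℕ.*-distribˡ-∸ (4 * ℓ) (4 * Q k) ℓ ⟨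
  4 * ℓ * (4 * Q k ∸ ℓ)             ∎)
  where
  open ≡-Reasoning
  regroup : ∀ ℓ q → 16 * ℓ * q ≡ 4 * ℓ * (4 * q)
  regroup = solve-∀

M-divisors : ∀ k ℓ → 4 ∣ M k ℓ × ℓ ∣ M k ℓ × (4 * Q k ∸ ℓ) ∣ M k ℓ
M-divisors k ℓ = subst (λ N → 4 ∣ N × ℓ ∣ N × t ∣ N) (sym (M≡4ℓt/g² k ℓ))
  (∣-product/square {gcd ℓ 4} {4} {ℓ} {t} g≢0 g∣4 g∣ℓ (∣m∣n⇒∣m∸n (∣m⇒∣m*n (Q k) g∣4) g∣ℓ))
  where
  t = 4 * Q k ∸ ℓ
  g≢0 : gcd ℓ 4 ≢ 0
  g≢0 = gcd[m,n]≢0 ℓ 4 (inj₂ λ ())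
  g∣ℓ : gcd ℓ 4 ∣ ℓ
  g∣ℓ = gcd[m,n]∣m ℓ 4
  g∣4 : gcd ℓ 4 ∣ 4
  g∣4 = gcd[m,n]∣n ℓ 4

lemma2 : (k ℓ p : ℕ) → 1 ≤ ℓ → ℓ ≤ 2 * Q k → gcd ℓ (Q k) ≡ 1 → Prime p → M k ℓ ∣ p + Q k →
    (frac (+ 4) p ≡ (frac (+ 4) (p + Q k) +ℚ frac ((+ (4 * Q k)) - (+ ℓ)) (p * (p + Q k))) +ℚ frac (+ ℓ) (p * (p + Q k)))
    × IsUnitFraction (frac (+ 4) (p + Q k))
    × IsUnitFraction (frac ((+ (4 * Q k)) - (+ ℓ)) (p * (p + Q k)))
    × IsUnitFraction (frac (+ ℓ) (p * (p + Q k)))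
lemma2 k ℓ zero _ _ _ p-prime _ = ⊥-elim (¬prime[0] p-prime)
lemma2 k ℓ (suc p) _ ℓ≤2q _ _ M∣p+q =
  frac-split (+ 4) (+ (4 * q)) (+ ℓ) p q (ℤ.pos-* 4 q) ,
  ∣⇒isUnitFraction 4 _ (∣-trans 4∣M M∣p+q) ,
  subst (λ t → IsUnitFraction (frac t (suc p * (suc p + q)))) (sym (pos-∸ ℓ≤4q))
    (∣⇒isUnitFraction (4 * q ∸ ℓ) _ (∣-trans t∣M M∣p[p+q])) ,
  ∣⇒isUnitFraction ℓ _ (∣-trans ℓ∣M M∣p[p+q])
  where
  q = Q k
  ℓ≤4q : ℓ ≤ 4 * q
  ℓ≤4q = ℕ.≤-trans ℓ≤2q (ℕ.*-monoˡ-≤ q (ℕ.m≤m+n 2 2))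
  M∣p[p+q] : M k ℓ ∣ suc p * (suc p + q)
  M∣p[p+q] = ∣n⇒∣m*n (suc p) M∣p+q
  4∣M : 4 ∣ M k ℓ
  4∣M = proj₁ (M-divisors k ℓ)
  ℓ∣M : ℓ ∣ M k ℓ
  ℓ∣M = proj₁ (proj₂ (M-divisors k ℓ))
  t∣M : 4 * q ∸ ℓ ∣ M k ℓ
  t∣M = proj₂ (proj₂ (M-divisors k ℓ))
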